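{- Let $\Theta\vdash P::\Gamma$ be derivable in CHOP. Then there exists a chop-free process $Q$ such that $\Theta\vdash Q::\Gamma$ is derivable.
   Context: CHOP (Classical Higher-Order Processes). Channel names $x,y,z,\dots$; process variables $p,q,r$; parameter labels $l$ (constants); type variables $X$. A parameter record $\rho=\{l_1=x_1,\dots,l_k=x_k\}$ maps distinct labels to channel names. Processes: $P,Q,R ::= x[y].(P\mid Q)\mid x(y).P\mid x[\mathsf{inl}].P\mid x[\mathsf{inr}].P\mid x.\mathsf{case}(P,Q)\mid ?x[y].P\mid !x(y).P\mid x[A].P\mid x(X).P\mid x[\lambda\rho.P]$ (send the abstraction $\lambda\rho.P$, which binds the names in the image of $\rho$; that image must be exactly the free channel names of $P$) $\mid x(p).P$ (receive an abstraction into $p$, bound in $P$) $\mid p\langle\rho\rangle$ (run) $\mid x[\,]\mid x().P\mid x.\mathsf{case}()\mid x\leftrightarrow^A y$ (link) $\mid(\nu x^A y)(P\mid Q)$ (parallel composition, $x$ bound in $P$, $y$ in $Q$) $\mid \mathsf{let}\ p=\lambda\rho.Q\ \mathsf{in}\ P$ (explicit substitution, $p$ bound in $P$). In $x[y].(P\mid Q)$, $x(y).P$, $?x[y].P$, $!x(y).P$ the name $y$ is bound in the continuation $P$; in $x(X).P$, $X$ is bound. Processes are up to $\alpha$-equivalence. Session types: $A,B::=A\otimes B\mid A⅋B\mid A\oplus B\mid A\&B\mid 0\mid\top\mid1\mid\bot\mid ?A\mid !A\mid\exists X.A\mid\forall X.A\mid X\mid X^\perp\mid\mathsf{send}(\Gamma)\mid\mathsf{recv}(\Gamma)$,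 where a process type $\Gamma=s_1:A_1,\dots,s_n:A_n$ maps distinct keys (all labels or all channels) to session types, order irrelevant; $\Gamma,\Delta$ is the union of disjoint $\Gamma,\Delta$. Duality $A^\perp$: $(X)^\perp=X^\perp$, $(X^\perp)^\perp=X$, $\otimes/⅋$, $\oplus/\&$, $0/\top$, $1/\bot$, $?/!$, $\exists/\forall$ are swapped componentwise ($(A\otimes B)^\perp=A^\perp⅋B^\perp$, $(?A)^\perp=!(A^\perp)$, $(\exists X.A)^\perp=\forall X.A^\perp$, etc.), and $\mathsf{send}(\Gamma)^\perp=\mathsf{recv}(\Gamma)$, $\mathsf{recv}(\Gamma)^\perp=\mathsf{send}(\Gamma)$. $\Gamma\rho$ is $\Gamma$ with each label $l$ replaced by $\rho(l)$; $?\Gamma$ means every type in $\Gamma$ has the form $?A$. A process environment $\Theta=p_1:\Gamma_1,\dots,p_n:\Gamma_n$ has distinct variables; $\cdot$ is empty. Typing rules for $\Theta\vdash P::\Gamma$: (Axiom) $\cdot\vdash x\leftrightarrow^A y::x:A^\perp,y:A$. (Cut) $\Theta\vdash P::\Gamma,x:A$ and $\Theta'\vdash Q::\Delta,y:A^\perp$ give $\Theta,\Theta'\vdash(\nu x^Ay)(P\mid Q)::\Gamma,\Delta$. ($\otimes$) $\Theta\vdash P::\Gamma,y:A$ and $\Theta'\vdash Q::\Delta,x:B$ give $\Theta,\Theta'\vdash x[y].(P\mid Q)::\Gamma,\Delta,x:A\otimes B$. ($⅋$) $\Theta\vdash P::\Gamma,y:A,x:B$ gives $\Theta\vdash x(y).P::\Gamma,x:A⅋B$.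 ($\oplus_1$,$\oplus_2$) $\Theta\vdash P::\Gamma,x:A$ (resp. $x:B$) gives $\Theta\vdash x[\mathsf{inl}].P$ (resp. $x[\mathsf{inr}].P$) $::\Gamma,x:A\oplus B$. ($\&$) $\Theta\vdash P::\Gamma,x:A$ and $\Theta\vdash Q::\Gamma,x:B$ give $\Theta\vdash x.\mathsf{case}(P,Q)::\Gamma,x:A\&B$. ($?$) $\Theta\vdash P::\Gamma,y:A$ gives $\Theta\vdash ?x[y].P::\Gamma,x:?A$. ($!$) $\cdot\vdash P::?\Gamma,y:A$ gives $\cdot\vdash !x(y).P::?\Gamma,x:!A$. ($\exists$) $\Theta\vdash P::\Gamma,x:B\{A/X\}$ gives $\Theta\vdash x[A].P::\Gamma,x:\exists X.B$. ($\forall$) $\Theta\vdash P::\Gamma,x:B$, $X$ not free in $\Theta,\Gamma$, gives $\Theta\vdash x(X).P::\Gamma,x:\forall X.B$. (Weaken) $\Theta\vdash P::\Gamma$ gives $\Theta\vdash P::\Gamma,x:?A$. (Contract) $\Theta\vdash P::\Gamma,y:?A,z:?A$ gives $\Theta\vdash P\{x/y,x/z\}::\Gamma,x:?A$. ($1$) $\cdot\vdash x[\,]::x:1$. ($\bot$) $\Theta\vdash P::\Gamma$ gives $\Theta\vdash x().P::\Gamma,x:\bot$. ($\top$) $\Theta\vdash x.\mathsf{case}()::\Gamma,x:\top$. (No rule for $0$.) (Id) $p:\Gamma\vdash p\langle\rho\rangle::\Gamma\rho$. (Chop) $\Theta\vdash P::\Delta\rho$ and $\Theta',p:\Delta\vdash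 Q::\Gamma$ give $\Theta,\Theta'\vdash\mathsf{let}\ p=\lambda\rho.P\ \mathsf{in}\ Q::\Gamma$. ($\mathsf{send}$) $\Theta\vdash P::\Gamma\rho$ gives $\Theta\vdash x[\lambda\rho.P]::x:\mathsf{send}(\Gamma)$. ($\mathsf{recv}$) $\Theta,p:\Delta\vdash P::\Gamma$ gives $\Theta\vdash x(p).P::\Gamma,x:\mathsf{recv}(\Delta)$. A process is chop-free if its typing derivation contains no application of rule Chop. -}

module Defs where

open import Data.Nat using (ℕ; zero; suc; _+_; _<ᵇ_; _≡ᵇ_; pred)
open import Data.Bool using (Bool; true; false; if_then_else_; _∨_)
open import Data.List using (List; []; _∷_; map; _++_)
open import Data.List.Membership.Propositional using (_∈_; _∉_)
open import Data.List.Relation.Binary.Subset.Propositional using (_⊆_)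
open import Data.List.Relation.Binary.Permutation.Propositional using (_↭_)
open import Data.List.Relation.Unary.Unique.Propositional using (Unique)
open import Data.List.Relation.Unary.All using (All)
open import Data.List.Relation.Binary.Disjoint.Propositional using (Disjoint)
open import Data.Product using (_×_; _,_; proj₁; proj₂; Σ)
open import Data.Maybe using (Maybe; just; nothing)
open import Data.Empty using (⊥)
open import Data.Unit using (⊤)
open import Relation.Binary.PropositionalEquality using (_≡_; _≢_)

-- Names.  Channels, labels and process variables are (separate sorts of)
-- natural numbers.  Type variables are de Bruijn indices, so that
-- syntactic equality of types is alpha-equivalence.

Chan : Set
Chan = ℕ

Label : Set
Label = ℕ

PVar : Set
PVar = ℕ

-- A label-keyed process type  l₁:A₁,…,lₙ:Aₙ  (distinct labels, order
-- irrelevant) is a finite map from labels to types.  It is represented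
-- canonically (so that syntactic equality = equality of finite maps) as
-- the list of its entries sorted by strictly increasing label, in "gap"
-- encoding: the entry  g ⦂ A ∷ Γ  at base b has label b + g, and the rest
-- Γ starts at base b + g + 1.  See 'entries' below.

mutual
  data Ty : Set where
    _⊗_ _⅋_ _⊕_ _&_ : Ty → Ty → Ty
    𝟎 ⊤ₜ 𝟏 ⊥ₜ : Ty
    `?_ `!_ : Ty → Ty
    `∃ `∀ : Ty → Ty
    var : ℕ → Ty
    var⊥ : ℕ → Ty
    send recv : LCtx → Ty

  data LCtx : Set where
    ε : LCtx
    _⦂_∷_ : ℕ → Ty → LCtx → LCtx

entriesFrom : ℕ → LCtx → List (Label × Ty)
entriesFrom b ε = []
entriesFrom b (g ⦂ A ∷ Γ) = (b + g , A) ∷ entriesFrom (suc (b + g)) Γ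

entries : LCtx → List (Label × Ty)
entries = entriesFrom 0

dual : Ty → Ty
dual (A ⊗ B) = dual A ⅋ dual B
dual (A ⅋ B) = dual A ⊗ dual B
dual (A ⊕ B) = dual A & dual B
dual (A & B) = dual A ⊕ dual B
dual 𝟎 = ⊤ₜ
dual ⊤ₜ = 𝟎
dual 𝟏 = ⊥ₜ
dual ⊥ₜ = 𝟏
dual (`? A) = `! dual A
dual (`! A) = `? dual A
dual (`∃ A) = `∀ (dual A)
dual (`∀ A) = `∃ (dual A)
dual (var n) = var⊥ n
dual (var⊥ n) = var n
dual (send Γ) = recv Γ
dual (recv Γ) = send Γ

mutual
  shift : ℕ → Ty → Ty
  shift c (A ⊗ B) = shift c A ⊗ shift c B
  shift c (A ⅋ B) = shift c A ⅋ shift c B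
  shift c (A ⊕ B) = shift c A ⊕ shift c B
  shift c (A & B) = shift c A & shift c B
  shift c 𝟎 = 𝟎
  shift c ⊤ₜ = ⊤ₜ
  shift c 𝟏 = 𝟏
  shift c ⊥ₜ = ⊥ₜ
  shift c (`? A) = `? shift c A
  shift c (`! A) = `! shift c A
  shift c (`∃ A) = `∃ (shift (suc c) A)
  shift c (`∀ A) = `∀ (shift (suc c) A)
  shift c (var n) = var (if n <ᵇ c then n else suc n)
  shift c (var⊥ n) = var⊥ (if n <ᵇ c then n else suc n)
  shift c (send Γ) = send (shiftL c Γ)
  shift c (recv Γ) = recv (shiftL c Γ)

  shiftL : ℕ → LCtx → LCtx
  shiftL c ε = ε
  shiftL c (g ⦂ A ∷ Γ) = g ⦂ shift c A ∷ shiftL c Γ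

mutual
  -- sub n A B : substitute A for type variable n in B (capture-avoiding),
  -- decrementing the variables above n (the binder of n is removed)
  sub : ℕ → Ty → Ty → Ty
  sub n C (A ⊗ B) = sub n C A ⊗ sub n C B
  sub n C (A ⅋ B) = sub n C A ⅋ sub n C B
  sub n C (A ⊕ B) = sub n C A ⊕ sub n C B
  sub n C (A & B) = sub n C A & sub n C B
  sub n C 𝟎 = 𝟎
  sub n C ⊤ₜ = ⊤ₜ
  sub n C 𝟏 = 𝟏
  sub n C ⊥ₜ = ⊥ₜ
  sub n C (`? A) = `? sub n C A
  sub n C (`! A) = `! sub n C A
  sub n C (`∃ A) = `∃ (sub (suc n) (shift 0 C) A)
  sub n C (`∀ A) = `∀ (sub (suc n) (shift 0 C) A)
  sub n C (var m) =
    if m ≡ᵇ n then C else (if n <ᵇ m then var (pred m) else var m)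
  sub n C (var⊥ m) =
    if m ≡ᵇ n then dual C else (if n <ᵇ m then var⊥ (pred m) else var⊥ m)
  sub n C (send Γ) = send (subL n C Γ)
  sub n C (recv Γ) = recv (subL n C Γ)

  subL : ℕ → Ty → LCtx → LCtx
  subL n C ε = ε
  subL n C (g ⦂ A ∷ Γ) = g ⦂ sub n C A ∷ subL n C Γ

_[_/0] : Ty → Ty → Ty
B [ A /0] = sub 0 A B

-- Γ = x₁:A₁,…,xₙ:Aₙ ; order is made irrelevant by the exchange rule,
-- distinctness of keys by the side conditions of the typing rules.
CCtx : Set
CCtx = List (Chan × Ty)

PCtx : Set
PCtx = List (PVar × LCtx)

Rec : Set
Rec = List (Label × Chan)

dom : {K V : Set} → List (K × V) → List K
dom = map proj₁

image : Rec → List Chan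
image = map proj₂

shiftC : CCtx → CCtx
shiftC = map (λ { (x , A) → (x , shift 0 A) })

shiftΘ : PCtx → PCtx
shiftΘ = map (λ { (p , Δ) → (p , shiftL 0 Δ) })

lookupR : Rec → Label → Maybe Chan
lookupR [] l = nothing
lookupR ((l' , x) ∷ ρ) l = if l ≡ᵇ l' then just x else lookupR ρ l

applyR : Rec → List (Label × Ty) → Maybe CCtx
applyR ρ [] = just []
applyR ρ ((l , A) ∷ Γ) with lookupR ρ l | applyR ρ Γ
... | just x | just Γ' = just ((x , A) ∷ Γ')
... | _ | _ = nothing

-- Γ' is Γρ : ρ is a record (distinct labels), every label of Γ is
-- replaced by ρ(l), and the result is a process type (distinct channels).
_·_≔_ : LCtx → Rec → CCtx → Set
Γ · ρ ≔ Γ' = Unique (dom ρ) × applyR ρ (entries Γ) ≡ just Γ' × Unique (dom Γ')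

AllWhyNot : CCtx → Set
AllWhyNot = All (λ { (_ , A) → IsWhyNot A })
  where
  IsWhyNot : Ty → Set
  IsWhyNot (`? _) = ⊤
  IsWhyNot _ = ⊥

data Proc : Set where
  out    : Chan → Chan → Proc → Proc → Proc
  inp    : Chan → Chan → Proc → Proc
  inl    : Chan → Proc → Proc
  inr    : Chan → Proc → Proc
  case   : Chan → Proc → Proc → Proc
  whyout : Chan → Chan → Proc → Proc
  bang   : Chan → Chan → Proc → Proc
  tout   : Chan → Ty → Proc → Proc
  tin    : Chan → Proc → Proc
  aout   : Chan → Rec → Proc → Proc
  ain    : Chan → PVar → Proc → Proc
  run    : PVar → Rec → Proc
  close  : Chan → Proc
  wait   : Chan → Proc → Proc
  absurd : Chan → Proc
  link   : Chan → Ty → Chan → Proc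
  cut    : Chan → Ty → Chan → Proc → Proc → Proc
  letp   : PVar → Rec → Proc → Proc → Proc   -- let p = λρ.Q in P  as  letp p ρ Q P

del : Chan → List Chan → List Chan
del y [] = []
del y (z ∷ zs) = if z ≡ᵇ y then del y zs else z ∷ del y zs

delAll : List Chan → List Chan → List Chan
delAll [] zs = zs
delAll (y ∷ ys) zs = delAll ys (del y zs)

fn : Proc → List Chan
fn (out x y P Q) = x ∷ del y (fn P) ++ fn Q
fn (inp x y P) = x ∷ del y (fn P)
fn (inl x P) = x ∷ fn P
fn (inr x P) = x ∷ fn P
fn (case x P Q) = x ∷ fn P ++ fn Q
fn (whyout x y P) = x ∷ del y (fn P)
fn (bang x y P) = x ∷ del y (fn P)
fn (tout x A P) = x ∷ fn P
fn (tin x P) = x ∷ fn P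
fn (aout x ρ P) = x ∷ delAll (image ρ) (fn P)
fn (ain x p P) = x ∷ fn P
fn (run p ρ) = image ρ
fn (close x) = x ∷ []
fn (wait x P) = x ∷ fn P
fn (absurd x) = x ∷ []
fn (link x A y) = x ∷ y ∷ []
fn (cut x A y P Q) = del x (fn P) ++ del y (fn Q)
fn (letp p ρ Q P) = delAll (image ρ) (fn Q) ++ fn P

bn : Proc → List Chan
bn (out x y P Q) = y ∷ bn P ++ bn Q
bn (inp x y P) = y ∷ bn P
bn (inl x P) = bn P
bn (inr x P) = bn P
bn (case x P Q) = bn P ++ bn Q
bn (whyout x y P) = y ∷ bn P
bn (bang x y P) = y ∷ bn P
bn (tout x A P) = bn P
bn (tin x P) = bn P
bn (aout x ρ P) = image ρ ++ bn P
bn (ain x p P) = bn P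
bn (run p ρ) = []
bn (close x) = []
bn (wait x P) = bn P
bn (absurd x) = []
bn (link x A y) = []
bn (cut x A y P Q) = x ∷ y ∷ bn P ++ bn Q
bn (letp p ρ Q P) = image ρ ++ bn Q ++ bn P

hide : Chan → (Chan → Chan) → Chan → Chan
hide y σ c = if c ≡ᵇ y then c else σ c

hideAll : List Chan → (Chan → Chan) → Chan → Chan
hideAll [] σ = σ
hideAll (y ∷ ys) σ = hide y (hideAll ys σ)

renR : (Chan → Chan) → Rec → Rec
renR σ = map (λ { (l , c) → (l , σ c) })

ren : (Chan → Chan) → Proc → Proc
ren σ (out x y P Q) = out (σ x) y (ren (hide y σ) P) (ren σ Q)
ren σ (inp x y P) = inp (σ x) y (ren (hide y σ) P)
ren σ (inl x P) = inl (σ x) (ren σ P)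
ren σ (inr x P) = inr (σ x) (ren σ P)
ren σ (case x P Q) = case (σ x) (ren σ P) (ren σ Q)
ren σ (whyout x y P) = whyout (σ x) y (ren (hide y σ) P)
ren σ (bang x y P) = bang (σ x) y (ren (hide y σ) P)
ren σ (tout x A P) = tout (σ x) A (ren σ P)
ren σ (tin x P) = tin (σ x) (ren σ P)
ren σ (aout x ρ P) = aout (σ x) ρ (ren (hideAll (image ρ) σ) P)
ren σ (ain x p P) = ain (σ x) p (ren σ P)
ren σ (run p ρ) = run p (renR σ ρ)
ren σ (close x) = close (σ x)
ren σ (wait x P) = wait (σ x) (ren σ P)
ren σ (absurd x) = absurd (σ x)
ren σ (link x A y) = link (σ x) A (σ y)
ren σ (cut x A y P Q) = cut x A y (ren (hide x σ) P) (ren (hide y σ) Q)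
ren σ (letp p ρ Q P) = letp p ρ (ren (hideAll (image ρ) σ) Q) (ren σ P)

_/_,_ : Chan → Chan → Chan → Chan → Chan
(x / y , z) c = if (c ≡ᵇ y) ∨ (c ≡ᵇ z) then x else c

-- Typing  Θ ⊢ P ⦂ Γ
-- "Γ , x:A" is written (x , A) ∷ Γ; "Γ , Δ" is Γ ++ Δ.

infix 4 _⊢_⦂_

data _⊢_⦂_ : PCtx → Proc → CCtx → Set where
  axiom : ∀ {x y A} → x ≢ y →
          [] ⊢ link x A y ⦂ (x , dual A) ∷ (y , A) ∷ []
  cutR : ∀ {Θ Θ' P Q Γ Δ x y A} →
         Θ ⊢ P ⦂ (x , A) ∷ Γ → Θ' ⊢ Q ⦂ (y , dual A) ∷ Δ →
         Disjoint (dom Θ) (dom Θ') → Disjoint (dom Γ) (dom Δ) →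
         Θ ++ Θ' ⊢ cut x A y P Q ⦂ Γ ++ Δ
  ⊗R : ∀ {Θ Θ' P Q Γ Δ x y A B} →
       Θ ⊢ P ⦂ (y , A) ∷ Γ → Θ' ⊢ Q ⦂ (x , B) ∷ Δ →
       Disjoint (dom Θ) (dom Θ') → Disjoint (dom Γ) (dom Δ) → x ∉ dom Γ →
       Θ ++ Θ' ⊢ out x y P Q ⦂ (x , A ⊗ B) ∷ Γ ++ Δ
  ⅋R : ∀ {Θ P Γ x y A B} →
       Θ ⊢ P ⦂ (y , A) ∷ (x , B) ∷ Γ →
       Θ ⊢ inp x y P ⦂ (x , A ⅋ B) ∷ Γ
  ⊕₁R : ∀ {Θ P Γ x A B} →
        Θ ⊢ P ⦂ (x , A) ∷ Γ → Θ ⊢ inl x P ⦂ (x , A ⊕ B) ∷ Γ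
  ⊕₂R : ∀ {Θ P Γ x A B} →
        Θ ⊢ P ⦂ (x , B) ∷ Γ → Θ ⊢ inr x P ⦂ (x , A ⊕ B) ∷ Γ
  &R : ∀ {Θ P Q Γ x A B} →
       Θ ⊢ P ⦂ (x , A) ∷ Γ → Θ ⊢ Q ⦂ (x , B) ∷ Γ →
       Θ ⊢ case x P Q ⦂ (x , A & B) ∷ Γ
  ?R : ∀ {Θ P Γ x y A} →
       Θ ⊢ P ⦂ (y , A) ∷ Γ → x ∉ dom Γ →
       Θ ⊢ whyout x y P ⦂ (x , `? A) ∷ Γ
  !R : ∀ {P Γ x y A} →
       [] ⊢ P ⦂ (y , A) ∷ Γ → AllWhyNot Γ → x ∉ dom Γ →
       [] ⊢ bang x y P ⦂ (x , `! A) ∷ Γ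
  ∃R : ∀ {Θ P Γ x A B} →
       Θ ⊢ P ⦂ (x , B [ A /0]) ∷ Γ →
       Θ ⊢ tout x A P ⦂ (x , `∃ B) ∷ Γ
  -- X not free in Θ,Γ: in de Bruijn form, Θ and Γ are shifted past X
  ∀R : ∀ {Θ P Γ x B} →
       shiftΘ Θ ⊢ P ⦂ (x , B) ∷ shiftC Γ →
       Θ ⊢ tin x P ⦂ (x , `∀ B) ∷ Γ
  weaken : ∀ {Θ P Γ x A} →
           Θ ⊢ P ⦂ Γ → x ∉ dom Γ →
           Θ ⊢ P ⦂ (x , `? A) ∷ Γ
  -- P{x/y,x/z}; the representative P is chosen so that x is not bound in P
  contract : ∀ {Θ P Γ x y z A} →
             Θ ⊢ P ⦂ (y , `? A) ∷ (z , `? A) ∷ Γ → x ∉ dom Γ → x ∉ bn P →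
             Θ ⊢ ren (x / y , z) P ⦂ (x , `? A) ∷ Γ
  𝟏R : ∀ {x} → [] ⊢ close x ⦂ (x , 𝟏) ∷ []
  ⊥R : ∀ {Θ P Γ x} →
       Θ ⊢ P ⦂ Γ → x ∉ dom Γ →
       Θ ⊢ wait x P ⦂ (x , ⊥ₜ) ∷ Γ
  ⊤R : ∀ {Θ Γ x} →
       Unique (dom Θ) → Unique (x ∷ dom Γ) →
       Θ ⊢ absurd x ⦂ (x , ⊤ₜ) ∷ Γ
  idR : ∀ {p Γ ρ Γρ} →
        Γ · ρ ≔ Γρ →
        (p , Γ) ∷ [] ⊢ run p ρ ⦂ Γρ
  chop : ∀ {Θ Θ' p ρ P Q Γ Δ Δρ} →
         Δ · ρ ≔ Δρ → Θ ⊢ P ⦂ Δρ → (p , Δ) ∷ Θ' ⊢ Q ⦂ Γ →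
         Disjoint (dom Θ) (dom Θ') →
         Θ ++ Θ' ⊢ letp p ρ P Q ⦂ Γ
  sendR : ∀ {Θ P Γ Γρ ρ x} →
          Γ · ρ ≔ Γρ → Θ ⊢ P ⦂ Γρ →
          fn P ⊆ image ρ → image ρ ⊆ fn P →
          Θ ⊢ aout x ρ P ⦂ (x , send Γ) ∷ []
  recvR : ∀ {Θ P Γ Δ p x} →
          (p , Δ) ∷ Θ ⊢ P ⦂ Γ → p ∉ dom Θ → x ∉ dom Γ →
          Θ ⊢ ain x p P ⦂ (x , recv Δ) ∷ Γ
  exch : ∀ {Θ Θ' P Γ Γ'} →
         Θ ⊢ P ⦂ Γ → Θ ↭ Θ' → Γ ↭ Γ' →
         Θ' ⊢ P ⦂ Γ'

ChopFree : ∀ {Θ P Γ} → Θ ⊢ P ⦂ Γ → Set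
ChopFree (axiom _) = ⊤
ChopFree (cutR d e _ _) = ChopFree d × ChopFree e
ChopFree (⊗R d e _ _ _) = ChopFree d × ChopFree e
ChopFree (⅋R d) = ChopFree d
ChopFree (⊕₁R d) = ChopFree d
ChopFree (⊕₂R d) = ChopFree d
ChopFree (&R d e) = ChopFree d × ChopFree e
ChopFree (?R d _) = ChopFree d
ChopFree (!R d _ _) = ChopFree d
ChopFree (∃R d) = ChopFree d
ChopFree (∀R d) = ChopFree d
ChopFree (weaken d _) = ChopFree d
ChopFree (contract d _ _) = ChopFree d
ChopFree 𝟏R = ⊤
ChopFree (⊥R d _) = ChopFree d
ChopFree (⊤R _ _) = ⊤
ChopFree (idR _) = ⊤
ChopFree (chop _ _ _ _) = ⊥
ChopFree (sendR _ d _ _) = ChopFree d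
ChopFree (recvR d _ _) = ChopFree d
ChopFree (exch d _ _) = ChopFree d

module Submission where

open import Defs
open import Data.Bool using (true; false; T)
open import Data.Empty using (⊥-elim)
open import Data.List using (List; []; _∷_; _++_)
open import Data.List.Extrema.Nat using (max; xs≤max)
open import Data.List.Membership.Propositional using (_∈_; _∉_)
open import Data.List.Membership.Propositional.Properties using (∈-∃++; ∈-++⁺ˡ; ∈-++⁺ʳ; ∈-++⁻)
open import Data.List.Properties using (map-++)
open import Data.List.Relation.Binary.Disjoint.Propositional using (Disjoint)
open import Data.List.Relation.Binary.Permutation.Propositional using (_↭_; refl; prep; swap; trans; ↭-sym; ↭⇒↭ₛ)
open import Data.List.Relation.Binary.Permutation.Propositional.Properties using (++-identityʳ; ∷↭∷ʳ) renaming (map⁺ to ↭-map⁺; shift to ↭-shift)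
import Data.List.Relation.Binary.Permutation.Setoid.Properties as Permutationₛ
open import Data.List.Relation.Binary.Subset.Propositional using (_⊆_)
open import Data.List.Relation.Binary.Subset.Propositional.Properties using (⊆-refl)
open import Data.List.Relation.Unary.All using ([]; _∷_; tabulate) renaming (lookup to All-lookup)
open import Data.List.Relation.Unary.All.Properties using (All¬⇒¬Any)
open import Data.List.Relation.Unary.AllPairs using ([]; _∷_)
open import Data.List.Relation.Unary.Any using (here; there)
open import Data.List.Relation.Unary.Unique.Propositional using (Unique)
open import Data.List.Relation.Unary.Unique.Propositional.Properties using (++⁺; Unique[x∷xs]⇒x∉xs)
open import Data.Maybe using (just; nothing)
open import Data.Nat using (ℕ; suc; NonZero; _+_; _≡ᵇ_; _≤_; _<_; _≟_; s≤s)
open import Data.Nat.Properties using (≡ᵇ⇒≡; ≡⇒≡ᵇ; 1+n≢n; <⇒≢; <-irrefl; ≤-refl; ≤-trans; m≤m+n; m≢1+n+m; n≤1+n; +-cancelʳ-≡)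
open import Data.Product using (Σ; _,_; _×_; proj₁; proj₂)
open import Data.Sum using (inj₁; inj₂)
open import Data.Unit using (tt)
open import Function using (_∘_)
open import Relation.Nullary using (yes; no)
open import Relation.Binary.PropositionalEquality using (_≡_; _≢_; refl; sym; cong; cong₂; subst; setoid) renaming (trans to ≡-trans)

-- A chop  let p = λρ.P in Q  is replaced by a cut between the sender
-- x[λρ.P] and the receiver y(p).Q.  Rule send demands that the image of ρ
-- be exactly the free names of the sent process; so every channel of its
-- type is first made free by cutting it against a link, and ρ is extended
-- by fresh labels naming all free names, which avoids needing any invariant
-- relating free names to typing contexts.  Contraction P{x/y,x/z} cannot be
-- rebuilt on the chop-free replacement of P (its bound names may capture x);
-- instead z(y).P is cut against a chop-free process of type
-- !A⊥ ⊗ !A⊥, x:?A that performs the contraction on names of its own.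

Unique-resp-↭ : {xs ys : List ℕ} → xs ↭ ys → Unique xs → Unique ys
Unique-resp-↭ p = Permutationₛ.Unique-resp-↭ (setoid ℕ) (↭⇒↭ₛ p)

fresh : List ℕ → ℕ
fresh xs = suc (max 0 xs)

<fresh : ∀ {x xs} → x ∈ xs → x < fresh xs
<fresh {xs = xs} x∈xs = s≤s (All-lookup (xs≤max 0 xs) x∈xs)

fresh∉ : ∀ xs → fresh xs ∉ xs
fresh∉ xs m = <-irrefl refl (<fresh m)

≡ᵇ≡true⇒≡ : ∀ {m n} → (m ≡ᵇ n) ≡ true → m ≡ n
≡ᵇ≡true⇒≡ {m} {n} eq = ≡ᵇ⇒≡ m n (subst T (sym eq) tt)

≡ᵇ≡false⇒≢ : ∀ {m n} → (m ≡ᵇ n) ≡ false → m ≢ n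
≡ᵇ≡false⇒≢ {m} eq refl = subst T eq (≡⇒≡ᵇ m m refl)

∈-del⁺ : ∀ {x y zs} → x ∈ zs → x ≢ y → x ∈ del y zs
∈-del⁺ {y = y} {z ∷ zs} x∈ x≢y with z ≡ᵇ y in z≡ᵇy
∈-del⁺ (here refl) x≢y | true = ⊥-elim (x≢y (≡ᵇ≡true⇒≡ z≡ᵇy))
∈-del⁺ (there x∈) x≢y | true = ∈-del⁺ x∈ x≢y
∈-del⁺ (here refl) x≢y | false = here refl
∈-del⁺ (there x∈) x≢y | false = there (∈-del⁺ x∈ x≢y)

Unique-dom-++ : ∀ {A : Set} (xs ys : List (ℕ × A)) →
                Unique (dom xs) → Unique (dom ys) → Disjoint (dom xs) (dom ys) →
                Unique (dom (xs ++ ys))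
Unique-dom-++ xs ys u v dj = subst Unique (sym (map-++ proj₁ xs ys)) (++⁺ u v dj)

infix 4 _⊢ᶜᶠ_⦂_ _⊩_

_⊢ᶜᶠ_⦂_ : PCtx → Proc → CCtx → Set
Θ ⊢ᶜᶠ P ⦂ Γ = Σ (Θ ⊢ P ⦂ Γ) ChopFree

_⊩_ : PCtx → CCtx → Set
Θ ⊩ Γ = Σ Proc λ P → Θ ⊢ᶜᶠ P ⦂ Γ

dom-shiftΘ : ∀ Θ → dom (shiftΘ Θ) ≡ dom Θ
dom-shiftΘ [] = refl
dom-shiftΘ ((p , _) ∷ Θ) = cong (p ∷_) (dom-shiftΘ Θ)

env-unique : ∀ {Θ P Γ} → Θ ⊢ P ⦂ Γ → Unique (dom Θ)
env-unique (axiom _) = []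
env-unique (cutR {Θ = Θ} {Θ'} d e dj _) = Unique-dom-++ Θ Θ' (env-unique d) (env-unique e) dj
env-unique (⊗R {Θ = Θ} {Θ'} d e dj _ _) = Unique-dom-++ Θ Θ' (env-unique d) (env-unique e) dj
env-unique (⅋R d) = env-unique d
env-unique (⊕₁R d) = env-unique d
env-unique (⊕₂R d) = env-unique d
env-unique (&R d _) = env-unique d
env-unique (?R d _) = env-unique d
env-unique (!R _ _ _) = []
env-unique (∃R d) = env-unique d
env-unique (∀R {Θ = Θ} d) = subst Unique (dom-shiftΘ Θ) (env-unique d)
env-unique (weaken d _) = env-unique d
env-unique (contract d _ _) = env-unique d
env-unique 𝟏R = []
env-unique (⊥R d _) = env-unique d
env-unique (⊤R u _) = u
env-unique (idR _) = [] ∷ []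
env-unique (chop {Θ = Θ} {Θ'} _ d e dj) with env-unique e
... | _ ∷ u = Unique-dom-++ Θ Θ' (env-unique d) u dj
env-unique (sendR _ d _ _) = env-unique d
env-unique (recvR d _ _) with env-unique d
... | _ ∷ u = u
env-unique (exch d π _) = Unique-resp-↭ (↭-map⁺ proj₁ π) (env-unique d)

relay : Chan → Ty → Proc → Proc
relay c A P = cut c A (suc c) P (link (suc c) A c)

⊢-relay : ∀ {Θ P Γ c A} → Θ ⊢ᶜᶠ P ⦂ Γ → (c , A) ∈ Γ → Unique (dom Γ) →
          Θ ⊢ᶜᶠ relay c A P ⦂ Γ
⊢-relay {Θ} {c = c} {A} (d , cf) c∈Γ u with ∈-∃++ c∈Γ
... | Γ₁ , Γ₂ , refl =
  exch (cutR (exch d refl to-front) (axiom 1+n≢n) (λ { (_ , ()) }) c-apart)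
       (++-identityʳ Θ) (↭-sym (trans to-front (∷↭∷ʳ (c , A) (Γ₁ ++ Γ₂))))
  , cf , tt
  where
  to-front : Γ₁ ++ (c , A) ∷ Γ₂ ↭ (c , A) ∷ Γ₁ ++ Γ₂
  to-front = ↭-shift (c , A) Γ₁ Γ₂
  c-apart : Disjoint (dom (Γ₁ ++ Γ₂)) (c ∷ [])
  c-apart (c∈ , here refl) =
    Unique[x∷xs]⇒x∉xs (Unique-resp-↭ (↭-map⁺ proj₁ to-front) u) c∈

c∈fn-relay : ∀ {c A P} → c ∈ fn (relay c A P)
c∈fn-relay {c} {P = P} =
  ∈-++⁺ʳ (del c (fn P)) (∈-del⁺ {zs = suc c ∷ c ∷ []} (there (here refl)) (1+n≢n ∘ sym))

∈-fn-relay⁺ : ∀ {x c A P} → x ∈ fn P → x ∈ fn (relay c A P)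
∈-fn-relay⁺ {x} {c} {A} {P} x∈ with x ≟ c
... | yes refl = c∈fn-relay {c} {A} {P}
... | no x≢c = ∈-++⁺ˡ (∈-del⁺ x∈ x≢c)

relayAll : CCtx → Proc → Proc
relayAll [] P = P
relayAll ((c , A) ∷ Γ) P = relayAll Γ (relay c A P)

⊢-relayAll : ∀ {Θ P Γ} Γ₀ → Γ₀ ⊆ Γ → Unique (dom Γ) →
             Θ ⊢ᶜᶠ P ⦂ Γ → Θ ⊢ᶜᶠ relayAll Γ₀ P ⦂ Γ
⊢-relayAll [] Γ₀⊆Γ u d = d
⊢-relayAll (_ ∷ Γ₀) Γ₀⊆Γ u d =
  ⊢-relayAll Γ₀ (Γ₀⊆Γ ∘ there) u (⊢-relay d (Γ₀⊆Γ (here refl)) u)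

∈-fn-relayAll⁺ : ∀ Γ {P x} → x ∈ fn P → x ∈ fn (relayAll Γ P)
∈-fn-relayAll⁺ [] x∈ = x∈
∈-fn-relayAll⁺ ((c , A) ∷ Γ) {P} x∈ = ∈-fn-relayAll⁺ Γ (∈-fn-relay⁺ {c = c} {A} {P} x∈)

dom⊆fn-relayAll : ∀ Γ {P} → dom Γ ⊆ fn (relayAll Γ P)
dom⊆fn-relayAll ((c , A) ∷ Γ) {P} (here refl) = ∈-fn-relayAll⁺ Γ (c∈fn-relay {c} {A} {P})
dom⊆fn-relayAll (_ ∷ Γ) (there c∈) = dom⊆fn-relayAll Γ c∈

restrict : Rec → List (Label × Ty) → Rec
restrict ρ [] = []
restrict ρ ((l , _) ∷ E) with lookupR ρ l
... | just x = (l , x) ∷ restrict ρ E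
... | nothing = []

restrict-correct : ∀ ρ E {Γ} → applyR ρ E ≡ just Γ →
                   dom (restrict ρ E) ≡ dom E × image (restrict ρ E) ≡ dom Γ ×
                   (∀ {l} → l ∈ dom E → lookupR (restrict ρ E) l ≡ lookupR ρ l)
restrict-correct ρ [] refl = refl , refl , λ ()
restrict-correct ρ ((l , A) ∷ E) applied with lookupR ρ l in ρl | applyR ρ E in rest
... | just x | just Γ with applied
... | refl with restrict-correct ρ E rest
... | dom-eq , image-eq , lookup-eq = cong (l ∷_) dom-eq , cong (x ∷_) image-eq , lookup-eq′
  where
  lookup-eq′ : ∀ {l′} → l′ ∈ l ∷ dom E → lookupR ((l , x) ∷ restrict ρ E) l′ ≡ lookupR ρ l′
  lookup-eq′ {l′} l′∈ with l′ ≡ᵇ l in l′≡ᵇl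
  lookup-eq′ {l′} l′∈ | true with ≡ᵇ≡true⇒≡ {l′} {l} l′≡ᵇl
  ... | refl = sym ρl
  lookup-eq′ {l′} (here l′≡l) | false = ⊥-elim (≡ᵇ≡false⇒≢ {l′} l′≡ᵇl l′≡l)
  lookup-eq′ (there l′∈E) | false = lookup-eq l′∈E
restrict-correct ρ ((l , A) ∷ E) () | just x | nothing
restrict-correct ρ ((l , A) ∷ E) () | nothing | _

lookupR-++ˡ : ∀ (ρ₁ ρ₂ : Rec) {l} → l ∈ dom ρ₁ → lookupR (ρ₁ ++ ρ₂) l ≡ lookupR ρ₁ l
lookupR-++ˡ ((l′ , _) ∷ ρ₁) ρ₂ {l} l∈ with l ≡ᵇ l′ in l≡ᵇl′ | l∈
... | true | _ = refl
... | false | here l≡l′ = ⊥-elim (≡ᵇ≡false⇒≢ l≡ᵇl′ l≡l′)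
... | false | there l∈ρ₁ = lookupR-++ˡ ρ₁ ρ₂ l∈ρ₁

applyR-cong : ∀ ρ₁ ρ₂ E → (∀ {l} → l ∈ dom E → lookupR ρ₁ l ≡ lookupR ρ₂ l) →
              applyR ρ₁ E ≡ applyR ρ₂ E
applyR-cong ρ₁ ρ₂ [] same = refl
applyR-cong ρ₁ ρ₂ ((l , A) ∷ E) same
  rewrite same (here refl) | applyR-cong ρ₁ ρ₂ E (same ∘ there) = refl

labelFrom : ℕ → List Chan → Rec
labelFrom M [] = []
labelFrom M (c ∷ cs) = (M , c) ∷ labelFrom (suc M) cs

image-labelFrom : ∀ M cs → image (labelFrom M cs) ≡ cs
image-labelFrom M [] = refl
image-labelFrom M (c ∷ cs) = cong (c ∷_) (image-labelFrom (suc M) cs)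

labelFrom-≥ : ∀ M cs {l} → l ∈ dom (labelFrom M cs) → M ≤ l
labelFrom-≥ M (c ∷ cs) (here refl) = ≤-refl
labelFrom-≥ M (c ∷ cs) (there l∈) = ≤-trans (n≤1+n M) (labelFrom-≥ (suc M) cs l∈)

Unique-labelFrom : ∀ M cs → Unique (dom (labelFrom M cs))
Unique-labelFrom M [] = []
Unique-labelFrom M (c ∷ cs) =
  tabulate (<⇒≢ ∘ labelFrom-≥ (suc M) cs) ∷ Unique-labelFrom (suc M) cs

entriesFrom-≥ : ∀ b Γ {l} → l ∈ dom (entriesFrom b Γ) → b ≤ l
entriesFrom-≥ b (g ⦂ A ∷ Γ) (here refl) = m≤m+n b g
entriesFrom-≥ b (g ⦂ A ∷ Γ) (there l∈) =
  ≤-trans (≤-trans (m≤m+n b g) (n≤1+n (b + g))) (entriesFrom-≥ (suc (b + g)) Γ l∈)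

Unique-entriesFrom : ∀ b Γ → Unique (dom (entriesFrom b Γ))
Unique-entriesFrom b ε = []
Unique-entriesFrom b (g ⦂ A ∷ Γ) =
  tabulate (<⇒≢ ∘ entriesFrom-≥ (suc (b + g)) Γ) ∷ Unique-entriesFrom (suc (b + g)) Γ

-- ρ restricted to the labels of Δ, followed by fresh labels for cs.
extend-record : ∀ {Δ ρ Δρ} (cs : List Chan) → Δ · ρ ≔ Δρ →
                Σ Rec λ ρ′ → Δ · ρ′ ≔ Δρ × image ρ′ ≡ dom Δρ ++ cs
extend-record {Δ} {ρ} {Δρ} cs (_ , applied , uΔρ)
  with restrict-correct ρ (entries Δ) applied
... | dom-eq , image-eq , lookup-eq =
  ρ₁ ++ ρ₂ , (unique , applied′ , uΔρ) ,
  ≡-trans (map-++ proj₂ ρ₁ ρ₂) (cong₂ _++_ image-eq (image-labelFrom M cs))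
  where
  M = fresh (dom (entries Δ))
  ρ₁ = restrict ρ (entries Δ)
  ρ₂ = labelFrom M cs
  apart : Disjoint (dom ρ₁) (dom ρ₂)
  apart (l∈ρ₁ , l∈ρ₂) =
    <-irrefl refl (≤-trans (<fresh (subst (_ ∈_) dom-eq l∈ρ₁)) (labelFrom-≥ M cs l∈ρ₂))
  unique : Unique (dom (ρ₁ ++ ρ₂))
  unique = Unique-dom-++ ρ₁ ρ₂ (subst Unique (sym dom-eq) (Unique-entriesFrom 0 Δ))
                               (Unique-labelFrom M cs) apart
  applied′ : applyR (ρ₁ ++ ρ₂) (entries Δ) ≡ just Δρ
  applied′ = ≡-trans (applyR-cong (ρ₁ ++ ρ₂) ρ (entries Δ) λ l∈ →
                       ≡-trans (lookupR-++ˡ ρ₁ ρ₂ (subst (_ ∈_) (sym dom-eq) l∈)) (lookup-eq l∈))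
                     applied

⊢-send : ∀ {Θ Δ ρ Δρ} x → Δ · ρ ≔ Δρ → Θ ⊩ Δρ → Θ ⊩ (x , send Δ) ∷ []
⊢-send {Δ = Δ} {Δρ = Γ} x def@(_ , _ , uΓ) (P , d)
  with extend-record {Δ} (fn (relayAll Γ P)) def
... | ρ′ , def′ , image-eq = _ , sendR def′ (proj₁ d′) fn⊆image image⊆fn , proj₂ d′
  where
  d′ = ⊢-relayAll Γ ⊆-refl uΓ d
  fn⊆image : fn (relayAll Γ P) ⊆ image ρ′
  fn⊆image c∈ = subst (_ ∈_) (sym image-eq) (∈-++⁺ʳ (dom Γ) c∈)
  image⊆fn : image ρ′ ⊆ fn (relayAll Γ P)
  image⊆fn c∈ with ∈-++⁻ (dom Γ) (subst (_ ∈_) image-eq c∈)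
  ... | inj₁ c∈Γ = dom⊆fn-relayAll Γ c∈Γ
  ... | inj₂ c∈fn = c∈fn

forwarder : Chan → Chan → Chan → Chan → Ty → Proc
forwarder t a u b A = bang t a (whyout u b (link a A b))

⊢-forwarder : ∀ {t a u b A} → a ≢ b → u ≢ a → t ≢ u →
              [] ⊢ᶜᶠ forwarder t a u b A ⦂ (t , `! dual A) ∷ (u , `? A) ∷ []
⊢-forwarder a≢b u≢a t≢u =
  !R (exch (?R (exch (axiom a≢b) refl (swap _ _ refl)) λ { (here u≡a) → u≢a u≡a })
           refl (swap _ _ refl))
     (tt ∷ []) (λ { (here t≡u) → t≢u t≡u })
  , tt

-- The names k + x with k ≥ 1 differ from x, so contracting onto x captures nothing.
duplicator : Chan → Ty → Proc
duplicator x A =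
  ren (x / (5 + x) , (6 + x))
      (out (4 + x) (3 + x) (forwarder (3 + x) (1 + x) (5 + x) (2 + x) A)
                           (forwarder (4 + x) (1 + x) (6 + x) (2 + x) A))

⊢-duplicator : ∀ x A →
               [] ⊢ᶜᶠ duplicator x A ⦂ (4 + x , (`! dual A) ⊗ (`! dual A)) ∷ (x , `? A) ∷ []
⊢-duplicator x A =
  exch (contract (exch tensor refl (trans (swap _ _ refl) (prep _ (swap _ _ refl))))
                 (All¬⇒¬Any (x≢ 4 ∷ []))
                 (All¬⇒¬Any (x≢ 3 ∷ x≢ 1 ∷ x≢ 2 ∷ x≢ 1 ∷ x≢ 2 ∷ [])))
       refl (swap _ _ refl)
  , proj₂ forward₁ , proj₂ forward₂
  where
  x≢ : ∀ k .{{_ : NonZero k}} → x ≢ k + x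
  x≢ (suc k) = m≢1+n+m x
  apart : ∀ {i j} → i ≢ j → i + x ≢ j + x
  apart {i} {j} i≢j = i≢j ∘ +-cancelʳ-≡ x i j
  forward₁ = ⊢-forwarder {3 + x} {1 + x} {5 + x} {2 + x} {A} (apart λ ()) (apart λ ()) (apart λ ())
  forward₂ = ⊢-forwarder {4 + x} {1 + x} {6 + x} {2 + x} {A} (apart λ ()) (apart λ ()) (apart λ ())
  tensor = ⊗R (proj₁ forward₁) (proj₁ forward₂) (λ { (() , _) })
              (λ { (here u≡ , here v≡) → apart {5} {6} (λ ()) (≡-trans (sym u≡) v≡) })
              (λ { (here t≡u) → apart {4} {5} (λ ()) t≡u })

contract-by-cut : ∀ {Θ Γ x y z A} → Θ ⊩ (y , `? A) ∷ (z , `? A) ∷ Γ → x ∉ dom Γ →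
                  Θ ⊩ (x , `? A) ∷ Γ
contract-by-cut {Θ} {Γ} {x} {A = A} (_ , d , cf) x∉Γ with ⊢-duplicator x A
... | dup , cf-dup =
  _ , exch (cutR (⅋R d) dup (λ { (_ , ()) }) (λ { (x∈Γ , here refl) → x∉Γ x∈Γ }))
           (++-identityʳ Θ) (↭-sym (∷↭∷ʳ (x , `? A) Γ))
  , cf , cf-dup

chop-by-cut : ∀ {Θ Θ′ p ρ Γ Δ Δρ} → Δ · ρ ≔ Δρ → Θ ⊩ Δρ → (p , Δ) ∷ Θ′ ⊩ Γ →
              p ∉ dom Θ′ → Disjoint (dom Θ) (dom Θ′) → Θ ++ Θ′ ⊩ Γ
chop-by-cut {Γ = Γ} def P (_ , e , cf) p∉Θ′ apart with ⊢-send 0 def P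
... | _ , d , cf-send =
  _ , cutR d (recvR e p∉Θ′ (fresh∉ (dom Γ))) apart (λ { (() , _) }) , cf-send , cf

chop-elim : ∀ {Θ P Γ} → Θ ⊢ P ⦂ Γ → Θ ⊩ Γ
chop-elim (axiom x≢y) = _ , axiom x≢y , tt
chop-elim (cutR d e a b) =
  let (_ , d′ , c) = chop-elim d ; (_ , e′ , c′) = chop-elim e in _ , cutR d′ e′ a b , c , c′
chop-elim (⊗R d e a b n) =
  let (_ , d′ , c) = chop-elim d ; (_ , e′ , c′) = chop-elim e in _ , ⊗R d′ e′ a b n , c , c′
chop-elim (⅋R d) = let (_ , d′ , c) = chop-elim d in _ , ⅋R d′ , c
chop-elim (⊕₁R d) = let (_ , d′ , c) = chop-elim d in _ , ⊕₁R d′ , c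
chop-elim (⊕₂R d) = let (_ , d′ , c) = chop-elim d in _ , ⊕₂R d′ , c
chop-elim (&R d e) =
  let (_ , d′ , c) = chop-elim d ; (_ , e′ , c′) = chop-elim e in _ , &R d′ e′ , c , c′
chop-elim (?R d n) = let (_ , d′ , c) = chop-elim d in _ , ?R d′ n , c
chop-elim (!R d a n) = let (_ , d′ , c) = chop-elim d in _ , !R d′ a n , c
chop-elim (∃R d) = let (_ , d′ , c) = chop-elim d in _ , ∃R d′ , c
chop-elim (∀R d) = let (_ , d′ , c) = chop-elim d in _ , ∀R d′ , c
chop-elim (weaken d n) = let (_ , d′ , c) = chop-elim d in _ , weaken d′ n , c
chop-elim (contract d x∉Γ _) = contract-by-cut (chop-elim d) x∉Γ
chop-elim 𝟏R = _ , 𝟏R , tt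
chop-elim (⊥R d n) = let (_ , d′ , c) = chop-elim d in _ , ⊥R d′ n , c
chop-elim (⊤R u v) = _ , ⊤R u v , tt
chop-elim (idR def) = _ , idR def , tt
chop-elim (chop def d e apart) =
  chop-by-cut def (chop-elim d) (chop-elim e) (Unique[x∷xs]⇒x∉xs (env-unique e)) apart
chop-elim (sendR def d _ _) = ⊢-send _ def (chop-elim d)
chop-elim (recvR d p∉ x∉) = let (_ , d′ , c) = chop-elim d in _ , recvR d′ p∉ x∉ , c
chop-elim (exch d π σ) = let (_ , d′ , c) = chop-elim d in _ , exch d′ π σ , c

theorem4p6 : ∀ (Θ : PCtx) (P : Proc) (Γ : CCtx) →
    Θ ⊢ P ⦂ Γ →
    Σ Proc (λ Q → Σ (Θ ⊢ Q ⦂ Γ) ChopFree)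
theorem4p6 Θ P Γ = chop-elim
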